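{- For all integers $m,n\geq 1$, $n_\mathscr{D}(K_n\square K_m)=2+(2^n-2)(2^m-2)$.
   Context: $K_n$ is the complete graph on $n$ vertices and $G\square H$ denotes the Cartesian product of graphs $G$ and $H$. For a graph $G$ and $v\in V(G)$, $N[v]$ is the closed neighbourhood of $v$ (the neighbours of $v$ together with $v$), and for $S\subseteq V(G)$, $N[S]=\bigcup_{v\in S}N[v]$. A set $S\subseteq V(G)$ is digitally convex if for every $v\in V(G)$, $N[v]\subseteq N[S]$ implies $v\in S$ (in particular $\emptyset$ and $V(G)$ are digitally convex). $n_\mathscr{D}(G)$ denotes the number of digitally convex subsets of $V(G)$. -}

module Defs where

open import Data.Bool using (Bool; true; false; not; _∧_; _∨_)
open import Data.Nat using (ℕ; zero; suc; _*_)
open import Data.Fin using (Fin; remQuot)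
open import Data.Fin.Properties using (_≟_; any?)
open import Data.Fin.Subset using (Subset; _∈_; _⊆_; inside; outside)
open import Data.Fin.Subset.Properties using (_∈?_; _⊆?_)
open import Data.Vec using (Vec; []; _∷_; tabulate)
open import Data.List using (List; []; _∷_; _++_; map; filter; length)
open import Data.Product using (_,_; _×_; ∃; proj₁; proj₂)
open import Relation.Nullary using (Dec; yes; no; does; ¬_)
open import Relation.Nullary.Decidable using (_×-dec_; ¬?; _→-dec_)
open import Relation.Binary.PropositionalEquality using (_≡_; refl; sym; cong; cong₂)
open import Data.Empty using (⊥-elim)
open import Data.Bool.Properties using (∧-zeroʳ)

record Graph (N : ℕ) : Set where
  field
    adj   : Fin N → Fin N → Bool
    adj-sym : ∀ u v → adj u v ≡ adj v u
    adj-irr : ∀ v → adj v v ≡ false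
open Graph public

_==_ : ∀ {N} → Fin N → Fin N → Bool
u == v = does (u ≟ v)

N[_]∋ : ∀ {N} → Graph N → Fin N → Subset N
N[ G ]∋ v = tabulate (λ u → (u == v) ∨ adj G v u)

NS[_]∋ : ∀ {N} → Graph N → Subset N → Subset N
NS[ G ]∋ S = tabulate (λ u → does (any? (λ v → (v ∈? S) ×-dec (u ∈? N[ G ]∋ v))))

DigitallyConvex : ∀ {N} → Graph N → Subset N → Set
DigitallyConvex {N} G S = ∀ (v : Fin N) → N[ G ]∋ v ⊆ NS[ G ]∋ S → v ∈ S

digitallyConvex? : ∀ {N} (G : Graph N) (S : Subset N) → Dec (DigitallyConvex G S)
digitallyConvex? G S = Data.Fin.Properties.all? (λ v → (N[ G ]∋ v ⊆? NS[ G ]∋ S) →-dec (v ∈? S))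

allSubsets : (N : ℕ) → List (Subset N)
allSubsets zero    = [] ∷ []
allSubsets (suc N) = map (outside ∷_) (allSubsets N) ++ map (inside ∷_) (allSubsets N)

nD : ∀ {N} → Graph N → ℕ
nD {N} G = length (filter (digitallyConvex? G) (allSubsets N))

==-sym : ∀ {k} (u v : Fin k) → (u == v) ≡ (v == u)
==-sym u v with u ≟ v | v ≟ u
... | yes _ | yes _ = refl
... | no  _ | no  _ = refl
... | yes p | no ¬q = ⊥-elim (¬q (sym p))
... | no ¬p | yes q = ⊥-elim (¬p (sym q))

==-refl : ∀ {k} (v : Fin k) → (v == v) ≡ true
==-refl v with v ≟ v
... | yes _ = refl
... | no ¬p = ⊥-elim (¬p refl)

K : (n : ℕ) → Graph n
K n = record { adj = λ u v → not (u == v)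
             ; adj-sym = λ u v → cong not (==-sym u v)
             ; adj-irr = λ v → cong not (==-refl v) }

-- Cartesian product G □ H, with vertex set Fin (n * m) identified with
-- Fin n × Fin m via remQuot (the inverse of Data.Fin.combine):
-- (a,b) ~ (a',b') iff (a = a' and b ~_H b') or (b = b' and a ~_G a').
_□_ : ∀ {n m} → Graph n → Graph m → Graph (n * m)
_□_ {n} {m} G H = record { adj = A ; adj-sym = symP ; adj-irr = irrP }
  where
  fst : Fin (n * m) → Fin n
  fst x = proj₁ (remQuot {n} m x)
  snd : Fin (n * m) → Fin m
  snd x = proj₂ (remQuot {n} m x)
  A : Fin (n * m) → Fin (n * m) → Bool
  A x y = ((fst x == fst y) ∧ adj H (snd x) (snd y)) ∨ ((snd x == snd y) ∧ adj G (fst x) (fst y))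
  symP : ∀ x y → A x y ≡ A y x
  symP x y =
    cong₂ _∨_ (cong₂ _∧_ (==-sym (fst x) (fst y)) (adj-sym H (snd x) (snd y)))
              (cong₂ _∧_ (==-sym (snd x) (snd y)) (adj-sym G (fst x) (fst y)))
  irrP : ∀ x → A x x ≡ false
  irrP x rewrite adj-irr H (snd x) | adj-irr G (fst x)
      = cong₂ _∨_ (∧-zeroʳ (fst x == fst x)) (∧-zeroʳ (snd x == snd x))

module Submission where

-- Write a vertex as a pair (row, column); its closed neighbourhood is
-- its whole row together with its whole column.  We show that the
-- digitally convex sets are exactly
--   * ∅ and the whole vertex set, and
--   * the rectangles R × C with R ⊆ Fin n, C ⊆ Fin m both nonempty and
--     proper,
-- and that these 2 + (2^n − 2)(2^m − 2) sets are pairwise distinct.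
-- A convex set S is the rectangle spanned by its occupied rows and
-- columns, because every vertex on an occupied row and an occupied
-- column has its neighbourhood dominated by S; if every row (or column)
-- is occupied, S dominates everything and so is the whole vertex set.
-- Conversely a rectangle missing a row and a column is convex.

open import Defs
open import Data.Nat using (ℕ; _+_; _*_; _∸_; _^_; _≥_)
open import Relation.Binary.PropositionalEquality using (_≡_)

open import Data.Nat using (zero; suc)
open import Data.Nat.Properties using (+-identityʳ; m+n∸m≡n)
open import Data.Bool using (Bool; true; false; not; _∧_; _∨_)
open import Data.Fin as Fin using (Fin; combine; remQuot)
open import Data.Fin.Properties using (_≟_; any?; remQuot-combine; combine-remQuot)
open import Data.Fin.Subset using (Subset; _∈_; _∉_; _⊆_; ∁; Nonempty; Empty; inside; outside)
  renaming (⊥ to ∅; ⊤ to full)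
open import Data.Fin.Subset.Properties
  using (_∈?_; nonempty?; ∉⊥; ∈⊤; ⊆⊤; ⊆-antisym; Empty-unique; x∈∁p⇒x∉p; x∉∁p⇒x∈p)
open import Data.Vec using (_∷_; tabulate)
import Data.Vec as Vec
open import Data.Vec.Properties using (lookup∘tabulate; []=⇒lookup; lookup⇒[]=)
open import Data.List using (List; []; _∷_; _++_; map; filter; length; cartesianProduct)
open import Data.List.Properties using (length-map; length-++; map-∘; map-id-local)
open import Data.List.Membership.Propositional using () renaming (_∈_ to _∈ˡ_; _∉_ to _∉ˡ_)
open import Data.List.Membership.Propositional.Properties
  using (∈-map⁺; ∈-map⁻; ∈-filter⁺; ∈-filter⁻; ∈-++⁺ˡ; ∈-++⁺ʳ; ∈-cartesianProduct⁺; ∈-cartesianProduct⁻)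
open import Data.List.Membership.Propositional.Properties.WithK using (unique∧set⇒bag)
open import Data.List.Relation.Unary.Any using (here; there)
open import Data.List.Relation.Unary.All using (All)
import Data.List.Relation.Unary.All as All
open import Data.List.Relation.Unary.All.Properties using (¬Any⇒All¬)
import Data.List.Relation.Unary.AllPairs as AllPairs
open import Data.List.Relation.Unary.Unique.Propositional using (Unique)
import Data.List.Relation.Unary.Unique.Propositional.Properties as Unique
open import Data.List.Relation.Binary.BagAndSetEquality using (∼bag⇒↭)
open import Data.List.Relation.Binary.Permutation.Propositional.Properties using (↭-length)
open import Data.Product using (_,_; _×_; ∃; proj₁; proj₂; uncurry)
open import Data.Sum using (_⊎_; inj₁; inj₂)
import Data.Sum as Sum
open import Function using (_∘_)
open import Function.Bundles using (_⇔_; mk⇔; Equivalence)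
open Equivalence using (to; from)
open import Relation.Nullary using (Dec; yes; no; does; ¬_; contradiction)
open import Relation.Nullary.Decidable using (_×-dec_)
open import Relation.Binary.PropositionalEquality using (refl; sym; trans; cong; cong₂; subst; subst₂; _≢_; module ≡-Reasoning)

does≡true⇔ : ∀ {P : Set} (P? : Dec P) → does P? ≡ true ⇔ P
does≡true⇔ (yes p) = mk⇔ (λ _ → p) (λ _ → refl)
does≡true⇔ (no ¬p) = mk⇔ (λ ()) (λ p → contradiction p ¬p)

==⇔≡ : ∀ {k} {u v : Fin k} → (u == v) ≡ true ⇔ u ≡ v
==⇔≡ {u = u} {v} = does≡true⇔ (u ≟ v)

∈-tabulate⇔ : ∀ {k} (f : Fin k → Bool) {x : Fin k} → x ∈ tabulate f ⇔ f x ≡ true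
∈-tabulate⇔ f {x} =
  mk⇔ (λ x∈ → trans (sym (lookup∘tabulate f x)) ([]=⇒lookup x∈))
      (λ fx → lookup⇒[]= x (tabulate f) (trans (lookup∘tabulate f x) fx))

∈-decided⇔ : ∀ {k} {P : Fin k → Set} (P? : ∀ x → Dec (P x)) {x : Fin k} →
             x ∈ tabulate (λ y → does (P? y)) ⇔ P x
∈-decided⇔ P? {x} =
  mk⇔ (to (does≡true⇔ (P? x)) ∘ to (∈-tabulate⇔ _))
      (from (∈-tabulate⇔ _) ∘ from (does≡true⇔ (P? x)))

∁-empty⇒∈ : ∀ {k} {R : Subset k} → Empty (∁ R) → ∀ x → x ∈ R
∁-empty⇒∈ none x = x∉∁p⇒x∈p (λ x∈∁R → none (x , x∈∁R))

∁-empty⇒full : ∀ {k} {R : Subset k} → Empty (∁ R) → R ≡ full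
∁-empty⇒full none = ⊆-antisym ⊆⊤ (λ {x} _ → ∁-empty⇒∈ none x)

∅≢full : ∀ {k} → Fin k → ∅ ≢ full {k}
∅≢full x ∅≡full = ∉⊥ (subst (x ∈_) (sym ∅≡full) ∈⊤)

Proper : ∀ {k} → Subset k → Set
Proper R = Nonempty R × Nonempty (∁ R)

proper? : ∀ {k} (R : Subset k) → Dec (Proper R)
proper? R = nonempty? R ×-dec nonempty? (∁ R)

∅-improper : ∀ {k} → ¬ Proper (∅ {k})
∅-improper ((_ , x∈∅) , _) = ∉⊥ x∈∅

full-improper : ∀ {k} → ¬ Proper (full {k})
full-improper (_ , (_ , x∈∁full)) = x∈∁p⇒x∉p x∈∁full ∈⊤

subset-trichotomy : ∀ {k} (R : Subset k) → R ≡ ∅ ⊎ R ≡ full ⊎ Proper R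
subset-trichotomy R with nonempty? R | nonempty? (∁ R)
... | no  empty | _         = inj₁ (Empty-unique empty)
... | yes _     | no  ∁empty = inj₂ (inj₁ (∁-empty⇒full ∁empty))
... | yes ne    | yes ∁ne   = inj₂ (inj₂ (ne , ∁ne))

same-members⇒same-length : ∀ {A : Set} {xs ys : List A} → Unique xs → Unique ys →
  (∀ {z} → z ∈ˡ xs ⇔ z ∈ˡ ys) → length xs ≡ length ys
same-members⇒same-length uxs uys same = ↭-length (∼bag⇒↭ (unique∧set⇒bag uxs uys same))

unique-∷ : ∀ {A : Set} {x : A} {xs : List A} → x ∉ˡ xs → Unique xs → Unique (x ∷ xs)
unique-∷ {xs = xs} x∉xs uxs = ¬Any⇒All¬ xs x∉xs AllPairs.∷ uxs

unique-map-retract : ∀ {A B : Set} (f : A → B) (g : B → A) {xs : List A} →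
  All (λ x → g (f x) ≡ x) xs → Unique xs → Unique (map f xs)
unique-map-retract f g {xs} g∘f≡id uxs = Unique.map⁻ (subst Unique (sym g∘f∘xs≡xs) uxs)
  where
  g∘f∘xs≡xs : map g (map f xs) ≡ xs
  g∘f∘xs≡xs = trans (sym (map-∘ xs)) (map-id-local g∘f≡id)

length-cartesianProduct : ∀ {A B : Set} (xs : List A) (ys : List B) →
  length (cartesianProduct xs ys) ≡ length xs * length ys
length-cartesianProduct []       ys = refl
length-cartesianProduct (x ∷ xs) ys =
  trans (length-++ (map (x ,_) ys)) (cong₂ _+_ (length-map _ ys) (length-cartesianProduct xs ys))

allSubsets-complete : ∀ k (S : Subset k) → S ∈ˡ allSubsets k
allSubsets-complete zero    Vec.[]        = here refl
allSubsets-complete (suc k) (outside ∷ S) = ∈-++⁺ˡ (∈-map⁺ (outside ∷_) (allSubsets-complete k S))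
allSubsets-complete (suc k) (inside ∷ S)  =
  ∈-++⁺ʳ (map (outside ∷_) (allSubsets k)) (∈-map⁺ (inside ∷_) (allSubsets-complete k S))

allSubsets-unique : ∀ k → Unique (allSubsets k)
allSubsets-unique zero    = All.[] AllPairs.∷ AllPairs.[]
allSubsets-unique (suc k) =
  Unique.++⁺ (Unique.map⁺ ∷-injectiveʳ (allSubsets-unique k))
             (Unique.map⁺ ∷-injectiveʳ (allSubsets-unique k)) disjoint
  where
  ∷-injectiveʳ : ∀ {b} {S T : Subset k} → _≡_ {A = Subset (suc k)} (b ∷ S) (b ∷ T) → S ≡ T
  ∷-injectiveʳ refl = refl
  disjoint : ∀ {S} → ¬ (S ∈ˡ map (outside ∷_) (allSubsets k) × S ∈ˡ map (inside ∷_) (allSubsets k))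
  disjoint (S∈outs , S∈ins) with ∈-map⁻ (outside ∷_) S∈outs | ∈-map⁻ (inside ∷_) S∈ins
  ... | _ , _ , refl | _ , _ , ()

allSubsets-length : ∀ k → length (allSubsets k) ≡ 2 ^ k
allSubsets-length zero    = refl
allSubsets-length (suc k) = begin
  length (outs ++ ins)       ≡⟨ length-++ outs ⟩
  length outs + length ins   ≡⟨ cong₂ _+_ (length-map _ (allSubsets k)) (length-map _ (allSubsets k)) ⟩
  length (allSubsets k) + length (allSubsets k) ≡⟨ cong₂ _+_ (allSubsets-length k) (allSubsets-length k) ⟩
  2 ^ k + 2 ^ k              ≡⟨ cong (2 ^ k +_) (sym (+-identityʳ (2 ^ k))) ⟩
  2 ^ suc k                  ∎
  where
  open ≡-Reasoning
  outs ins : List (Subset (suc k))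
  outs = map (outside ∷_) (allSubsets k)
  ins  = map (inside ∷_) (allSubsets k)

properSubsets : ∀ k → List (Subset k)
properSubsets k = filter proper? (allSubsets k)

∈properSubsets⇔ : ∀ {k} {R : Subset k} → R ∈ˡ properSubsets k ⇔ Proper R
∈properSubsets⇔ {k} {R} =
  mk⇔ (proj₂ ∘ ∈-filter⁻ proper? {xs = allSubsets k}) (∈-filter⁺ proper? (allSubsets-complete k R))

-- There are 2^k − 2 nonempty proper subsets of Fin k when k ≥ 1: up to
-- order, allSubsets k is ∅ ∷ full ∷ properSubsets k.
properSubsets-length : ∀ k → length (properSubsets (suc k)) ≡ 2 ^ suc k ∸ 2
properSubsets-length k = begin
  length P                         ≡⟨ m+n∸m≡n 2 (length P) ⟨
  2 + length P ∸ 2                 ≡⟨ cong (_∸ 2) (same-members⇒same-length uniqueL (allSubsets-unique _) members) ⟩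
  length (allSubsets (suc k)) ∸ 2  ≡⟨ cong (_∸ 2) (allSubsets-length (suc k)) ⟩
  2 ^ suc k ∸ 2                    ∎
  where
  open ≡-Reasoning
  P : List (Subset (suc k))
  P = properSubsets (suc k)
  uniqueL : Unique (∅ ∷ full ∷ P)
  uniqueL = unique-∷ ∅∉ (unique-∷ (full-improper ∘ to ∈properSubsets⇔)
                                  (Unique.filter⁺ proper? (allSubsets-unique _)))
    where
    ∅∉ : ∅ ∉ˡ full ∷ P
    ∅∉ (here ∅≡full) = ∅≢full Fin.zero ∅≡full
    ∅∉ (there ∅∈P)   = ∅-improper (to ∈properSubsets⇔ ∅∈P)
  members : ∀ {R} → R ∈ˡ ∅ ∷ full ∷ P ⇔ R ∈ˡ allSubsets (suc k)
  members {R} = mk⇔ (λ _ → allSubsets-complete _ R) (λ _ → listed (subset-trichotomy R))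
    where
    listed : R ≡ ∅ ⊎ R ≡ full ⊎ Proper R → R ∈ˡ ∅ ∷ full ∷ P
    listed (inj₁ R≡∅)           = here R≡∅
    listed (inj₂ (inj₁ R≡full)) = there (here R≡full)
    listed (inj₂ (inj₂ proper)) = there (there (from ∈properSubsets⇔ proper))

∈N[]⇔ : ∀ {k} (G : Graph k) {u v : Fin k} → u ∈ N[ G ]∋ v ⇔ (u == v) ∨ adj G v u ≡ true
∈N[]⇔ G {v = v} = ∈-tabulate⇔ (λ u → (u == v) ∨ adj G v u)

v∈N[v] : ∀ {k} (G : Graph k) (v : Fin k) → v ∈ N[ G ]∋ v
v∈N[v] G v = from (∈N[]⇔ G) (cong (_∨ adj G v v) (==-refl v))

∈NS⇔ : ∀ {k} (G : Graph k) {S : Subset k} {u : Fin k} →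
       u ∈ NS[ G ]∋ S ⇔ ∃ λ w → w ∈ S × u ∈ N[ G ]∋ w
∈NS⇔ G {S} = ∈-decided⇔ (λ u → any? (λ v → (v ∈? S) ×-dec (u ∈? N[ G ]∋ v)))

∅-convex : ∀ {k} (G : Graph k) → DigitallyConvex G ∅
∅-convex G v N[v]⊆N[∅] with to (∈NS⇔ G) (N[v]⊆N[∅] (v∈N[v] G v))
... | _ , w∈∅ , _ = contradiction w∈∅ ∉⊥

full-convex : ∀ {k} (G : Graph k) → DigitallyConvex G full
full-convex G v _ = ∈⊤

dominating⇒full : ∀ {k} (G : Graph k) {S : Subset k} → DigitallyConvex G S →
                  (∀ u → u ∈ NS[ G ]∋ S) → S ≡ full
dominating⇒full G convex dominates = ⊆-antisym ⊆⊤ (λ {v} _ → convex v (λ {u} _ → dominates u))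

∈convexSubsets⇔ : ∀ {k} (G : Graph k) {S : Subset k} →
                  S ∈ˡ filter (digitallyConvex? G) (allSubsets k) ⇔ DigitallyConvex G S
∈convexSubsets⇔ {k} G {S} =
  mk⇔ (proj₂ ∘ ∈-filter⁻ (digitallyConvex? G) {xs = allSubsets k})
      (∈-filter⁺ (digitallyConvex? G) (allSubsets-complete k S))

-- The shape of the rook adjacency test: with a = (u == v), b = same row,
-- c = same column, `a ∨ (b xor c)' holds iff one of a, b, c does
-- (b and c together force a, since a vertex is determined by its coordinates).
∨-xor≡true⇔ : ∀ a b c → (b ≡ true → c ≡ true → a ≡ true) →
  a ∨ ((b ∧ not c) ∨ (c ∧ not b)) ≡ true ⇔ (a ≡ true ⊎ b ≡ true ⊎ c ≡ true)
∨-xor≡true⇔ true  _     _     _     = mk⇔ (λ _ → inj₁ refl) (λ _ → refl)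
∨-xor≡true⇔ false true  true  b∧c⇒a = mk⇔ (λ ()) (λ _ → b∧c⇒a refl refl)
∨-xor≡true⇔ false true  false _     = mk⇔ (λ _ → inj₂ (inj₁ refl)) (λ _ → refl)
∨-xor≡true⇔ false false true  _     = mk⇔ (λ _ → inj₂ (inj₂ refl)) (λ _ → refl)
∨-xor≡true⇔ false false false _     =
  mk⇔ (λ ()) (λ { (inj₁ ()) ; (inj₂ (inj₁ ())) ; (inj₂ (inj₂ ())) })

module RookGraph (n m : ℕ) where

  Rook : Graph (n * m)
  Rook = K n □ K m

  row : Fin (n * m) → Fin n
  row x = proj₁ (remQuot {n} m x)

  col : Fin (n * m) → Fin m
  col x = proj₂ (remQuot {n} m x)

  row-combine : ∀ a b → row (combine a b) ≡ a
  row-combine a b = cong proj₁ (remQuot-combine {n} {m} a b)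

  col-combine : ∀ a b → col (combine a b) ≡ b
  col-combine a b = cong proj₂ (remQuot-combine {n} {m} a b)

  combine-row-col : ∀ x → combine (row x) (col x) ≡ x
  combine-row-col x = combine-remQuot {n} m x

  vertex-≡ : ∀ {x y} → row x ≡ row y → col x ≡ col y → x ≡ y
  vertex-≡ {x} {y} rx≡ry cx≡cy =
    trans (sym (combine-row-col x)) (trans (cong₂ combine rx≡ry cx≡cy) (combine-row-col y))

  SameLine : Fin (n * m) → Fin (n * m) → Set
  SameLine u v = row u ≡ row v ⊎ col u ≡ col v

  ∈N[]⇔SameLine : ∀ {u v} → u ∈ N[ Rook ]∋ v ⇔ SameLine u v
  ∈N[]⇔SameLine {u} {v} =
    mk⇔ (fromBool ∘ to bool ∘ to (∈N[]⇔ Rook)) (from (∈N[]⇔ Rook) ∘ from bool ∘ toBool)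
    where
    Coincidence : Set
    Coincidence = (u == v) ≡ true ⊎ (row v == row u) ≡ true ⊎ (col v == col u) ≡ true
    bool : (u == v) ∨ adj Rook v u ≡ true ⇔ Coincidence
    bool = ∨-xor≡true⇔ (u == v) (row v == row u) (col v == col u)
             (λ r c → from ==⇔≡ (sym (vertex-≡ (to ==⇔≡ r) (to ==⇔≡ c))))
    fromBool : Coincidence → SameLine u v
    fromBool (inj₁ u≡v)        = inj₁ (cong row (to ==⇔≡ u≡v))
    fromBool (inj₂ (inj₁ r))   = inj₁ (sym (to ==⇔≡ r))
    fromBool (inj₂ (inj₂ c))   = inj₂ (sym (to ==⇔≡ c))
    toBool : SameLine u v → Coincidence
    toBool (inj₁ r) = inj₂ (inj₁ (from ==⇔≡ (sym r)))
    toBool (inj₂ c) = inj₂ (inj₂ (from ==⇔≡ (sym c)))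

  sameLine⇒∈NS : ∀ {S u w} → w ∈ S → SameLine u w → u ∈ NS[ Rook ]∋ S
  sameLine⇒∈NS {w = w} w∈S line = from (∈NS⇔ Rook) (w , w∈S , from ∈N[]⇔SameLine line)

  rect : Subset n → Subset m → Subset (n * m)
  rect R C = tabulate (λ x → does ((row x ∈? R) ×-dec (col x ∈? C)))

  ∈rect⇔ : ∀ R C {x} → x ∈ rect R C ⇔ (row x ∈ R × col x ∈ C)
  ∈rect⇔ R C = ∈-decided⇔ (λ x → (row x ∈? R) ×-dec (col x ∈? C))

  combine∈rect⇔ : ∀ R C {a b} → combine a b ∈ rect R C ⇔ (a ∈ R × b ∈ C)
  combine∈rect⇔ R C {a} {b} =
    subst₂ (λ a' b' → combine a b ∈ rect R C ⇔ (a' ∈ R × b' ∈ C)) (row-combine a b) (col-combine a b) (∈rect⇔ R C)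

  ∈N[rect]⇒col∈ : ∀ {R C u} → u ∈ NS[ Rook ]∋ (rect R C) → row u ∉ R → col u ∈ C
  ∈N[rect]⇒col∈ {R} {C} u∈NS row∉R with to (∈NS⇔ Rook) u∈NS
  ... | w , w∈rect , u∈N[w] with to (∈rect⇔ R C) w∈rect | to ∈N[]⇔SameLine u∈N[w]
  ...   | rw∈R , _ | inj₁ ru≡rw = contradiction (subst (_∈ R) (sym ru≡rw) rw∈R) row∉R
  ...   | _ , cw∈C | inj₂ cu≡cw = subst (_∈ C) (sym cu≡cw) cw∈C

  ∈N[rect]⇒row∈ : ∀ {R C u} → u ∈ NS[ Rook ]∋ (rect R C) → col u ∉ C → row u ∈ R
  ∈N[rect]⇒row∈ {R} {C} u∈NS col∉C with to (∈NS⇔ Rook) u∈NS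
  ... | w , w∈rect , u∈N[w] with to (∈rect⇔ R C) w∈rect | to ∈N[]⇔SameLine u∈N[w]
  ...   | rw∈R , _ | inj₁ ru≡rw = subst (_∈ R) (sym ru≡rw) rw∈R
  ...   | _ , cw∈C | inj₂ cu≡cw = contradiction (subst (_∈ C) (sym cu≡cw) cw∈C) col∉C

  -- A rectangle missing a row a' and a column b' is convex: if N[v] is
  -- dominated, then so are (a', col v) and (row v, b'), which forces
  -- col v ∈ C and row v ∈ R.
  rect-convex : ∀ {R C} → Nonempty (∁ R) → Nonempty (∁ C) → DigitallyConvex Rook (rect R C)
  rect-convex {R} {C} (a' , a'∈∁R) (b' , b'∈∁C) v N[v]⊆N[rect] = from (∈rect⇔ R C) (row∈R , col∈C)
    where
    col∈C : col v ∈ C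
    col∈C = subst (_∈ C) (col-combine a' (col v))
              (∈N[rect]⇒col∈ (N[v]⊆N[rect] (from ∈N[]⇔SameLine (inj₂ (col-combine a' (col v)))))
                             (subst (_∉ R) (sym (row-combine a' (col v))) (x∈∁p⇒x∉p a'∈∁R)))
    row∈R : row v ∈ R
    row∈R = subst (_∈ R) (row-combine (row v) b')
              (∈N[rect]⇒row∈ (N[v]⊆N[rect] (from ∈N[]⇔SameLine (inj₁ (row-combine (row v) b'))))
                             (subst (_∉ C) (sym (col-combine (row v) b')) (x∈∁p⇒x∉p b'∈∁C)))

  rows : Subset (n * m) → Subset n
  rows S = tabulate (λ a → does (any? (λ (b : Fin m) → combine a b ∈? S)))

  cols : Subset (n * m) → Subset m
  cols S = tabulate (λ b → does (any? (λ (a : Fin n) → combine a b ∈? S)))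

  ∈rows⇔ : ∀ S {a} → a ∈ rows S ⇔ ∃ λ (b : Fin m) → combine a b ∈ S
  ∈rows⇔ S = ∈-decided⇔ (λ a → any? (λ b → combine a b ∈? S))

  ∈cols⇔ : ∀ S {b} → b ∈ cols S ⇔ ∃ λ (a : Fin n) → combine a b ∈ S
  ∈cols⇔ S = ∈-decided⇔ (λ b → any? (λ (a : Fin n) → combine a b ∈? S))

  row∈rows : ∀ {S x} → x ∈ S → row x ∈ rows S
  row∈rows {S} {x} x∈S = from (∈rows⇔ S) (col x , subst (_∈ S) (sym (combine-row-col x)) x∈S)

  col∈cols : ∀ {S x} → x ∈ S → col x ∈ cols S
  col∈cols {S} {x} x∈S = from (∈cols⇔ S) (row x , subst (_∈ S) (sym (combine-row-col x)) x∈S)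

  onOccupiedLine⇒∈NS : ∀ {S u} → row u ∈ rows S ⊎ col u ∈ cols S → u ∈ NS[ Rook ]∋ S
  onOccupiedLine⇒∈NS {S} {u} (inj₁ r∈rows) with to (∈rows⇔ S) r∈rows
  ... | b , ub∈S = sameLine⇒∈NS ub∈S (inj₁ (sym (row-combine (row u) b)))
  onOccupiedLine⇒∈NS {S} {u} (inj₂ c∈cols) with to (∈cols⇔ S) c∈cols
  ... | a , au∈S = sameLine⇒∈NS au∈S (inj₂ (sym (col-combine a (col u))))

  -- A convex set is the rectangle spanned by its occupied rows and
  -- columns: a vertex on an occupied row and an occupied column has its
  -- whole neighbourhood dominated.
  convex⇒rectangle : ∀ {S} → DigitallyConvex Rook S → S ≡ rect (rows S) (cols S)
  convex⇒rectangle {S} convex = ⊆-antisym (λ x∈S → from (∈rect⇔ (rows S) (cols S)) (row∈rows x∈S , col∈cols x∈S)) rect⊆S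
    where
    rect⊆S : rect (rows S) (cols S) ⊆ S
    rect⊆S {x} x∈rect = convex x (λ u∈N[x] → onOccupiedLine⇒∈NS (occupied (to ∈N[]⇔SameLine u∈N[x])))
      where
      occupied : ∀ {u} → SameLine u x → row u ∈ rows S ⊎ col u ∈ cols S
      occupied = Sum.map (λ r≡ → subst (_∈ rows S) (sym r≡) (proj₁ (to (∈rect⇔ (rows S) (cols S)) x∈rect)))
                         (λ c≡ → subst (_∈ cols S) (sym c≡) (proj₂ (to (∈rect⇔ (rows S) (cols S)) x∈rect)))

  convex-trichotomy : ∀ {S} → DigitallyConvex Rook S →
                      S ≡ ∅ ⊎ S ≡ full ⊎ (Proper (rows S) × Proper (cols S))
  convex-trichotomy {S} convex with nonempty? S | nonempty? (∁ (rows S)) | nonempty? (∁ (cols S))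
  ... | no empty | _ | _ = inj₁ (Empty-unique empty)
  ... | yes _ | no allRows | _ =
    inj₂ (inj₁ (dominating⇒full Rook convex (λ u → onOccupiedLine⇒∈NS (inj₁ (∁-empty⇒∈ allRows (row u))))))
  ... | yes _ | yes _ | no allCols =
    inj₂ (inj₁ (dominating⇒full Rook convex (λ u → onOccupiedLine⇒∈NS (inj₂ (∁-empty⇒∈ allCols (col u))))))
  ... | yes (x , x∈S) | yes rowMissing | yes colMissing =
    inj₂ (inj₂ (((row x , row∈rows x∈S) , rowMissing) , ((col x , col∈cols x∈S) , colMissing)))

  lines : Subset (n * m) → Subset n × Subset m
  lines S = rows S , cols S

  lines-rect : ∀ {R C} → Nonempty R → Nonempty C → lines (rect R C) ≡ (R , C)
  lines-rect {R} {C} (a , a∈R) (b , b∈C) = cong₂ _,_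
    (⊆-antisym (λ r∈ → proj₁ (to (combine∈rect⇔ R C) (proj₂ (to (∈rows⇔ (rect R C)) r∈))))
               (λ a'∈R → from (∈rows⇔ (rect R C)) (b , from (combine∈rect⇔ R C) (a'∈R , b∈C))))
    (⊆-antisym (λ c∈ → proj₂ (to (combine∈rect⇔ R C) (proj₂ (to (∈cols⇔ (rect R C)) c∈))))
               (λ b'∈C → from (∈cols⇔ (rect R C)) (a , from (combine∈rect⇔ R C) (a∈R , b'∈C))))

  properPairs : List (Subset n × Subset m)
  properPairs = cartesianProduct (properSubsets n) (properSubsets m)

  convexSets : List (Subset (n * m))
  convexSets = ∅ ∷ full ∷ map (uncurry rect) properPairs

  ∈properPairs⇔ : ∀ {R C} → (R , C) ∈ˡ properPairs ⇔ (Proper R × Proper C)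
  ∈properPairs⇔ {R} {C} =
    mk⇔ (λ p → let (R∈ , C∈) = ∈-cartesianProduct⁻ (properSubsets n) (properSubsets m) p
               in to ∈properSubsets⇔ R∈ , to ∈properSubsets⇔ C∈)
        (λ (pR , pC) → ∈-cartesianProduct⁺ (from ∈properSubsets⇔ pR) (from ∈properSubsets⇔ pC))

  convex⇔∈convexSets : ∀ {S} → DigitallyConvex Rook S ⇔ S ∈ˡ convexSets
  convex⇔∈convexSets {S} = mk⇔ (λ convex → listed convex (convex-trichotomy convex)) isConvex
    where
    listed : DigitallyConvex Rook S → S ≡ ∅ ⊎ S ≡ full ⊎ (Proper (rows S) × Proper (cols S)) →
             S ∈ˡ convexSets
    listed _      (inj₁ S≡∅)           = here S≡∅
    listed _      (inj₂ (inj₁ S≡full)) = there (here S≡full)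
    listed convex (inj₂ (inj₂ proper)) =
      there (there (subst (_∈ˡ map (uncurry rect) properPairs) (sym (convex⇒rectangle convex))
                          (∈-map⁺ (uncurry rect) (from ∈properPairs⇔ proper))))
    isConvex : S ∈ˡ convexSets → DigitallyConvex Rook S
    isConvex (here refl)         = ∅-convex Rook
    isConvex (there (here refl)) = full-convex Rook
    isConvex (there (there S∈))  with ∈-map⁻ (uncurry rect) S∈
    ... | (R , C) , p , refl with to ∈properPairs⇔ p
    ...   | (_ , rowMissing) , (_ , colMissing) = rect-convex rowMissing colMissing

  -- The candidates are pairwise distinct: a rectangle with nonempty sides is
  -- recovered from its occupied lines, is nonempty, and misses a vertex (a
  -- vertex x is needed to tell ∅ from the whole vertex set).
  convexSets-unique : Fin (n * m) → Unique convexSets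
  convexSets-unique x = unique-∷ ∅∉ (unique-∷ full∉ rects-unique)
    where
    rects-unique : Unique (map (uncurry rect) properPairs)
    rects-unique = unique-map-retract (uncurry rect) lines
      (All.tabulate (λ { {R , C} p → let ((ne , _) , (ne' , _)) = to ∈properPairs⇔ p in lines-rect ne ne' }))
      (Unique.cartesianProduct⁺ (Unique.filter⁺ proper? (allSubsets-unique n))
                                (Unique.filter⁺ proper? (allSubsets-unique m)))
    full∉ : full ∉ˡ map (uncurry rect) properPairs
    full∉ S∈ with ∈-map⁻ (uncurry rect) S∈
    ... | (R , C) , p , full≡rect with to ∈properPairs⇔ p
    ...   | (_ , (a , a∈∁R)) , ((b , _) , _) =
            x∈∁p⇒x∉p a∈∁R (proj₁ (to (combine∈rect⇔ R C) (subst (combine a b ∈_) full≡rect ∈⊤)))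
    ∅∉ : ∅ ∉ˡ full ∷ map (uncurry rect) properPairs
    ∅∉ (here ∅≡full) = ∅≢full x ∅≡full
    ∅∉ (there S∈) with ∈-map⁻ (uncurry rect) S∈
    ... | (R , C) , p , ∅≡rect with to ∈properPairs⇔ p
    ...   | ((a , a∈R) , _) , ((b , b∈C) , _) =
            ∉⊥ (subst (combine a b ∈_) (sym ∅≡rect) (from (combine∈rect⇔ R C) (a∈R , b∈C)))

  nD-rook : Fin (n * m) → nD Rook ≡ 2 + length (properSubsets n) * length (properSubsets m)
  nD-rook x = begin
    nD Rook                     ≡⟨ same-members⇒same-length convex-unique (convexSets-unique x) members ⟩
    length convexSets           ≡⟨ cong (2 +_) (length-map (uncurry rect) properPairs) ⟩
    2 + length properPairs      ≡⟨ cong (2 +_) (length-cartesianProduct (properSubsets n) (properSubsets m)) ⟩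
    2 + length (properSubsets n) * length (properSubsets m) ∎
    where
    open ≡-Reasoning
    convex-unique : Unique (filter (digitallyConvex? Rook) (allSubsets (n * m)))
    convex-unique = Unique.filter⁺ (digitallyConvex? Rook) (allSubsets-unique (n * m))
    members : ∀ {S} → S ∈ˡ filter (digitallyConvex? Rook) (allSubsets (n * m)) ⇔ S ∈ˡ convexSets
    members = mk⇔ (to convex⇔∈convexSets ∘ to (∈convexSubsets⇔ Rook))
                  (from (∈convexSubsets⇔ Rook) ∘ from convex⇔∈convexSets)

mainTheorem4 : ∀ (n m : ℕ) → n ≥ 1 → m ≥ 1 →
    nD (K n □ K m) ≡ 2 + (2 ^ n ∸ 2) * (2 ^ m ∸ 2)
mainTheorem4 (suc n) (suc m) _ _ = begin
  nD (K (suc n) □ K (suc m))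
    ≡⟨ RookGraph.nD-rook (suc n) (suc m) (combine {suc n} {suc m} Fin.zero Fin.zero) ⟩
  2 + length (properSubsets (suc n)) * length (properSubsets (suc m))
    ≡⟨ cong₂ (λ p q → 2 + p * q) (properSubsets-length n) (properSubsets-length m) ⟩
  2 + (2 ^ suc n ∸ 2) * (2 ^ suc m ∸ 2) ∎
  where open ≡-Reasoning
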